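{- Let $\lambda\in\mathbb{C}$ with $\lambda\neq 1$, let $r,k\in\mathbb{Z}$ and $n\ge 0$. Then \[ T_{n}^{(r,k)}(x|\lambda)=\sum_{m=0}^{n}\left\{ \sum_{l=0}^{n-m} \binom{n}{l+m} S_{2}(l+m,m)T_{n-m-l}^{(r,k)}(\lambda) \right\}(x)_{m}. \]
   Context: For $k\in\mathbb{Z}$, $Li_k(x)=\sum_{n\ge1}x^n/n^k$. For $r,k\in\mathbb{Z}$ the polynomials $T_n^{(r,k)}(x|\lambda)$ are defined by $\left(\frac{1-\lambda}{e^t-\lambda}\right)^r\frac{Li_{k}(1-e^{ -t})}{1-e^{ -t}}e^{xt}=\sum_{n\ge0}T_n^{(r,k)}(x|\lambda)\frac{t^n}{n!}$ (as formal power series in $t$), and $T_n^{(r,k)}(\lambda)=T_n^{(r,k)}(0|\lambda)$. $(x)_m=x(x-1)\cdots(x-m+1)$ is the falling factorial, and $S_2(l,m)$ denotes the Stirling numbers of the second kind, $(e^t-1)^m=m!\sum_{l\ge m}S_2(l,m)\frac{t^l}{l!}$. -}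

module Defs where

open import Level using (Level)
open import Data.Nat as ℕ using (ℕ; zero; suc; _∸_)
open import Data.Nat using (_!)
open import Data.Nat.Combinatorics using (_C_)
open import Data.Integer as ℤ using (ℤ; +_; -[1+_])
open import Data.List using (List; []; _∷_)
open import Algebra.Bundles using (CommutativeRing)

-- Stirling numbers of the second kind (standard recurrence;
-- equivalent to (e^t-1)^m = m! Σ_l S₂(l,m) t^l/l!).
S₂ : ℕ → ℕ → ℕ
S₂ zero    zero    = 1
S₂ zero    (suc m) = 0
S₂ (suc l) zero    = 0
S₂ (suc l) (suc m) = suc m ℕ.* S₂ l (suc m) ℕ.+ S₂ l m

module Series {c ℓ : Level} (R : CommutativeRing c ℓ) where
  open CommutativeRing R hiding (zero)

  fromℕ : ℕ → Carrier
  fromℕ zero    = 0#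
  fromℕ (suc n) = 1# + fromℕ n

  _^'_ : Carrier → ℕ → Carrier
  a ^' zero  = 1#
  a ^' suc n = a * (a ^' n)

  sumTo : ℕ → (ℕ → Carrier) → Carrier
  sumTo zero    f = f 0
  sumTo (suc n) f = sumTo n f + f (suc n)

  falling : Carrier → ℕ → Carrier
  falling x zero    = 1#
  falling x (suc m) = falling x m * (x - fromℕ m)

  -- formal power series in t: coefficient sequences (ordinary coefficients)
  PS : Set c
  PS = ℕ → Carrier

  oneS : PS
  oneS zero    = 1#
  oneS (suc _) = 0#

  scaleS : Carrier → PS → PS
  scaleS a f n = a * f n

  mulS : PS → PS → PS
  mulS f g n = sumTo n (λ i → f i * g (n ∸ i))

  powS : PS → ℕ → PS
  powS f zero    = oneS
  powS f (suc m) = mulS f (powS f m)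

  -- In what follows `inv n` is meant to be the inverse of (n+1) in R.
  module WithInverses (inv : ℕ → Carrier) where

    invFact : ℕ → Carrier
    invFact zero    = 1#
    invFact (suc n) = invFact n * inv n

    expS : Carrier → PS
    expS a n = (a ^' n) * invFact n

    -- reciprocal of a power series g whose constant term has inverse μ:
    -- recList g μ n = [h_n , h_{n-1} , … , h_0]
    recList : PS → Carrier → ℕ → List Carrier
    recList g μ zero    = μ ∷ []
    recList g μ (suc n) = (- (μ * conv 1 prev)) ∷ prev
      where
        prev = recList g μ n
        -- conv 1 prev = Σ_{i=1}^{n+1} g_i h_{n+1-i}
        conv : ℕ → List Carrier → Carrier
        conv i []       = 0#
        conv i (h ∷ hs) = g i * h + conv (suc i) hs

    recipS : PS → Carrier → PS
    recipS g μ n with recList g μ n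
    ... | h ∷ _ = h
    ... | []    = 0#

    eMinus : Carrier → PS
    eMinus λ' zero    = expS 1# zero - λ'
    eMinus λ' (suc n) = expS 1# (suc n)

    -- ((1-λ)/(e^t-λ))^r , μ being the inverse of (1-λ)
    factorR : Carrier → Carrier → ℤ → PS
    factorR λ' μ (+ m)     = powS (scaleS (1# - λ') (recipS (eMinus λ' ) μ)) m
    factorR λ' μ -[1+ m ]  = powS (scaleS μ (eMinus λ')) (suc m)

    -- u = 1 - e^{-t}
    uS : PS
    uS zero    = 0#
    uS (suc j) = - expS (- 1#) (suc j)

    -- coefficients of Li_k(u)/u = Σ_{n≥0} u^n/(n+1)^k
    liCoeff : ℤ → ℕ → Carrier
    liCoeff (+ m)    n = inv n ^' m
    liCoeff -[1+ m ] n = fromℕ (suc n) ^' suc m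

    -- Li_k(1-e^{-t})/(1-e^{-t}) as a series in t (u has zero constant term)
    liS : ℤ → PS
    liS k N = sumTo N (λ j → liCoeff k j * powS uS j N)

    T : Carrier → Carrier → ℤ → ℤ → ℕ → Carrier → Carrier
    T λ' μ r k n x = fromℕ (n !) * mulS (mulS (factorR λ' μ r) (liS k)) (expS x) n

-- Expanding e^{xt} shows that T_n(x|λ) is the binomial convolution Σ_L C(n,L) T_{n-L}(λ) x^L
-- (an Appell sequence); substituting x^L = Σ_m S₂(L,m) (x)_m and exchanging the two sums
-- gives the expansion in the falling-factorial basis. Nothing about the factor
-- ((1-λ)/(e^t-λ))^r Li_k(1-e^{-t})/(1-e^{-t}) is used beyond its being a power series.
module Submission where

open import Defs
open import Data.Nat using (ℕ; suc; _+_; _∸_)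
open import Data.Nat.Combinatorics using (_C_)
open import Data.Integer using (ℤ)
open import Algebra.Bundles using (CommutativeRing)

open import Level using (Level)
open import Data.Nat as ℕ using (zero; _!; _≤_; _<_; z≤n; s≤s)
import Data.Nat.Properties as ℕₚ
open ℕₚ
  using (≤-refl; m≤n⇒m≤1+n; m<n⇒m<1+n; +-∸-assoc; n∸n≡0;
         ∸-+-assoc; m∸n+n≡m; m∸[m∸n]≡n; _!*_!≢0)
open import Data.Nat.Combinatorics using (k![n∸k]!∣n!; nCk≡n!/k![n-k]!)
open import Data.Nat.DivMod using (_/_; m/n*n≡m)
open import Relation.Binary.PropositionalEquality as ≡ using (_≡_)
import Algebra.Solver.CommutativeMonoid as CommutativeMonoidSolver
import Algebra.Properties.CommutativeSemigroup as CommutativeSemigroupProperties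
import Algebra.Properties.Ring as RingProperties
import Relation.Binary.Reasoning.Setoid as SetoidReasoning

n!≡nCk*[k!*[n∸k]!] : ∀ {n k} → k ≤ n → n ! ≡ (n C k) ℕ.* (k ! ℕ.* (n ∸ k) !)
n!≡nCk*[k!*[n∸k]!] {n} {k} k≤n = begin
  n !                    ≡⟨ m/n*n≡m (k![n∸k]!∣n! k≤n) ⟨
  n ! / d ℕ.* d          ≡⟨ ≡.cong (ℕ._* d) (nCk≡n!/k![n-k]! k≤n) ⟨
  (n C k) ℕ.* d          ∎
  where
  open ≡.≡-Reasoning
  d = k ! ℕ.* (n ∸ k) !
  instance _ = k !* (n ∸ k) !≢0

l<m⇒S₂≡0 : ∀ {l m} → l < m → S₂ l m ≡ 0
l<m⇒S₂≡0 {zero}  {suc m} _ = ≡.refl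
l<m⇒S₂≡0 {suc l} {suc m} (s≤s l<m)
  rewrite l<m⇒S₂≡0 (m<n⇒m<1+n l<m) | l<m⇒S₂≡0 l<m = ≡.trans (ℕₚ.+-identityʳ _) (ℕₚ.*-zeroʳ (suc m))

module Properties {c ℓ : Level} (R : CommutativeRing c ℓ) where
  open CommutativeRing R renaming (_+_ to _⊕_) hiding (zero)
  open Series R
  open SetoidReasoning setoid
  open CommutativeMonoidSolver *-commutativeMonoid using (solve; _⊜_) renaming (_⊕_ to _⊗_)
  open CommutativeSemigroupProperties +-commutativeSemigroup using (interchange)
  open RingProperties ring using (-‿distribʳ-*)

  sumTo-cong : ∀ n {f g : ℕ → Carrier} → (∀ i → i ≤ n → f i ≈ g i) → sumTo n f ≈ sumTo n g
  sumTo-cong zero    f≈g = f≈g 0 z≤n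
  sumTo-cong (suc n) f≈g = +-cong (sumTo-cong n (λ i i≤n → f≈g i (m≤n⇒m≤1+n i≤n))) (f≈g (suc n) ≤-refl)

  sumTo-zero : ∀ n {f : ℕ → Carrier} → (∀ i → i ≤ n → f i ≈ 0#) → sumTo n f ≈ 0#
  sumTo-zero zero    f≈0 = f≈0 0 z≤n
  sumTo-zero (suc n) f≈0 =
    trans (+-cong (sumTo-zero n (λ i i≤n → f≈0 i (m≤n⇒m≤1+n i≤n))) (f≈0 (suc n) ≤-refl)) (+-identityˡ 0#)

  sumTo-+ : ∀ n (f g : ℕ → Carrier) → sumTo n (λ i → f i ⊕ g i) ≈ sumTo n f ⊕ sumTo n g
  sumTo-+ zero    f g = refl
  sumTo-+ (suc n) f g = trans (+-congʳ (sumTo-+ n f g)) (interchange _ _ _ _)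

  sumTo-*ˡ : ∀ n a (f : ℕ → Carrier) → a * sumTo n f ≈ sumTo n (λ i → a * f i)
  sumTo-*ˡ zero    a f = refl
  sumTo-*ˡ (suc n) a f = trans (distribˡ a _ _) (+-congʳ (sumTo-*ˡ n a f))

  sumTo-*ʳ : ∀ n a (f : ℕ → Carrier) → sumTo n f * a ≈ sumTo n (λ i → f i * a)
  sumTo-*ʳ zero    a f = refl
  sumTo-*ʳ (suc n) a f = trans (distribʳ a _ _) (+-congʳ (sumTo-*ʳ n a f))

  sumTo-suc-head : ∀ n (f : ℕ → Carrier) → sumTo (suc n) f ≈ f 0 ⊕ sumTo n (λ i → f (suc i))
  sumTo-suc-head zero    f = refl
  sumTo-suc-head (suc n) f = trans (+-congʳ (sumTo-suc-head n f)) (+-assoc _ _ _)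

  sumTo-reverse : ∀ n (f : ℕ → Carrier) → sumTo n f ≈ sumTo n (λ i → f (n ∸ i))
  sumTo-reverse zero    f = refl
  sumTo-reverse (suc n) f = begin
    sumTo n f ⊕ f (suc n)                   ≈⟨ +-congʳ (sumTo-reverse n f) ⟩
    sumTo n (λ i → f (n ∸ i)) ⊕ f (suc n)   ≈⟨ +-comm _ _ ⟩
    f (suc n) ⊕ sumTo n (λ i → f (n ∸ i))   ≈⟨ sumTo-suc-head n (λ i → f (suc n ∸ i)) ⟨
    sumTo (suc n) (λ i → f (suc n ∸ i))     ∎

  -- Both sides sum h m l over the triangle m + l ≤ n, by rows m and by diagonals L = m + l.
  sumTo-triangle : ∀ n (h : ℕ → ℕ → Carrier) →
    sumTo n (λ m → sumTo (n ∸ m) (h m)) ≈ sumTo n (λ L → sumTo L (λ m → h m (L ∸ m)))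
  sumTo-triangle zero    h = refl
  sumTo-triangle (suc n) h = begin
    sumTo (suc n) (λ m → sumTo (suc n ∸ m) (h m))
      ≈⟨ sumTo-suc-head n (λ m → sumTo (suc n ∸ m) (h m)) ⟩
    sumTo (suc n) (h 0) ⊕ sumTo n (λ m → sumTo (n ∸ m) (h (suc m)))
      ≈⟨ +-cong (sumTo-suc-head n (h 0)) (sumTo-triangle n (λ m → h (suc m))) ⟩
    (h 0 0 ⊕ sumTo n (λ L → h 0 (suc L))) ⊕ sumTo n (λ L → sumTo L (λ m → h (suc m) (L ∸ m)))
      ≈⟨ trans (+-assoc _ _ _) (+-congˡ (sym (sumTo-+ n _ _))) ⟩
    h 0 0 ⊕ sumTo n (λ L → h 0 (suc L) ⊕ sumTo L (λ m → h (suc m) (L ∸ m)))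
      ≈⟨ +-congˡ (sumTo-cong n (λ L _ → sumTo-suc-head L (λ m → h m (suc L ∸ m)))) ⟨
    h 0 0 ⊕ sumTo n (λ L → sumTo (suc L) (λ m → h m (suc L ∸ m)))
      ≈⟨ sumTo-suc-head n (λ L → sumTo L (λ m → h m (L ∸ m))) ⟨
    sumTo (suc n) (λ L → sumTo L (λ m → h m (L ∸ m))) ∎

  fromℕ-+ : ∀ a b → fromℕ (a + b) ≈ fromℕ a ⊕ fromℕ b
  fromℕ-+ zero    b = sym (+-identityˡ _)
  fromℕ-+ (suc a) b = trans (+-congˡ (fromℕ-+ a b)) (sym (+-assoc _ _ _))

  fromℕ-* : ∀ a b → fromℕ (a ℕ.* b) ≈ fromℕ a * fromℕ b
  fromℕ-* zero    b = sym (zeroˡ _)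
  fromℕ-* (suc a) b = begin
    fromℕ (b + a ℕ.* b)               ≈⟨ fromℕ-+ b (a ℕ.* b) ⟩
    fromℕ b ⊕ fromℕ (a ℕ.* b)         ≈⟨ +-cong (sym (*-identityˡ _)) (fromℕ-* a b) ⟩
    1# * fromℕ b ⊕ fromℕ a * fromℕ b  ≈⟨ distribʳ _ _ _ ⟨
    fromℕ (suc a) * fromℕ b           ∎

  x*falling : ∀ x m → x * falling x m ≈ fromℕ m * falling x m ⊕ falling x (suc m)
  x*falling x m = sym (begin
    M * F ⊕ F * (x - M)          ≈⟨ +-congˡ (distribˡ F x (- M)) ⟩
    M * F ⊕ (F * x ⊕ F * - M)    ≈⟨ +-congˡ (+-congˡ (sym (-‿distribʳ-* F M))) ⟩
    M * F ⊕ (F * x ⊕ - (F * M))  ≈⟨ +-congʳ (*-comm M F) ⟩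
    F * M ⊕ (F * x ⊕ - (F * M))  ≈⟨ +-congˡ (+-comm _ _) ⟩
    F * M ⊕ (- (F * M) ⊕ F * x)  ≈⟨ +-assoc _ _ _ ⟨
    (F * M ⊕ - (F * M)) ⊕ F * x  ≈⟨ +-congʳ (-‿inverseʳ _) ⟩
    0# ⊕ F * x                   ≈⟨ +-identityˡ _ ⟩
    F * x                        ≈⟨ *-comm F x ⟩
    x * F                        ∎)
    where
    F = falling x m
    M = fromℕ m

  ^'≈sumTo-S₂-falling : ∀ x L → x ^' L ≈ sumTo L (λ m → fromℕ (S₂ L m) * falling x m)
  ^'≈sumTo-S₂-falling x zero    = sym (trans (*-identityʳ _) (+-identityʳ _))
  ^'≈sumTo-S₂-falling x (suc L) = begin
    x * x ^' L                                    ≈⟨ *-congˡ (^'≈sumTo-S₂-falling x L) ⟩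
    x * sumTo L (λ m → s m * F m)                 ≈⟨ sumTo-*ˡ L x _ ⟩
    sumTo L (λ m → x * (s m * F m))               ≈⟨ sumTo-cong L (λ m _ → x*sF≈g+a m) ⟩
    sumTo L (λ m → g m ⊕ a m)                     ≈⟨ sumTo-+ L g a ⟩
    sumTo L g ⊕ sumTo L a                         ≈⟨ +-congʳ g-shift ⟩
    sumTo L (λ m → g (suc m)) ⊕ sumTo L a         ≈⟨ sumTo-+ L _ a ⟨
    sumTo L (λ m → g (suc m) ⊕ a m)               ≈⟨ sumTo-cong L (λ m _ → S₂-recurrence m) ⟨
    sumTo L (λ m → fromℕ (S₂ (suc L) (suc m)) * F (suc m))
      ≈⟨ trans (+-congʳ (zeroˡ _)) (+-identityˡ _) ⟨
    0# * 1# ⊕ sumTo L (λ m → fromℕ (S₂ (suc L) (suc m)) * F (suc m))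
      ≈⟨ sumTo-suc-head L _ ⟨
    sumTo (suc L) (λ m → fromℕ (S₂ (suc L) m) * F m) ∎
    where
    F : ℕ → Carrier
    F = falling x
    s g a : ℕ → Carrier
    s m = fromℕ (S₂ L m)
    g m = fromℕ (m ℕ.* S₂ L m) * F m
    a m = s m * F (suc m)

    x*sF≈g+a : ∀ m → x * (s m * F m) ≈ g m ⊕ a m
    x*sF≈g+a m = begin
      x * (s m * F m)                        ≈⟨ solve 3 (λ x s F → x ⊗ (s ⊗ F) ⊜ s ⊗ (x ⊗ F)) refl x (s m) (F m) ⟩
      s m * (x * F m)                        ≈⟨ *-congˡ (x*falling x m) ⟩
      s m * (fromℕ m * F m ⊕ F (suc m))      ≈⟨ distribˡ _ _ _ ⟩
      s m * (fromℕ m * F m) ⊕ a m            ≈⟨ +-congʳ (solve 3 (λ s M F → s ⊗ (M ⊗ F) ⊜ (M ⊗ s) ⊗ F) refl (s m) (fromℕ m) (F m)) ⟩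
      (fromℕ m * s m) * F m ⊕ a m            ≈⟨ +-congʳ (*-congʳ (fromℕ-* m (S₂ L m))) ⟨
      g m ⊕ a m                              ∎

    -- g vanishes at both ends of 0 … L + 1, since S₂ L (L + 1) = 0.
    g-shift : sumTo L g ≈ sumTo L (λ m → g (suc m))
    g-shift = begin
      sumTo L g                            ≈⟨ trans (+-congˡ g[L+1]≈0) (+-identityʳ _) ⟨
      sumTo (suc L) g                      ≈⟨ sumTo-suc-head L g ⟩
      0# * 1# ⊕ sumTo L (λ m → g (suc m))  ≈⟨ trans (+-congʳ (zeroˡ _)) (+-identityˡ _) ⟩
      sumTo L (λ m → g (suc m))            ∎
      where
      g[L+1]≈0 : g (suc L) ≈ 0#
      g[L+1]≈0 = begin
        fromℕ (suc L ℕ.* S₂ L (suc L)) * F (suc L)      ≈⟨ *-congʳ (fromℕ-* (suc L) (S₂ L (suc L))) ⟩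
        fromℕ (suc L) * fromℕ (S₂ L (suc L)) * F (suc L)
          ≈⟨ *-congʳ (*-congˡ (reflexive (≡.cong fromℕ (l<m⇒S₂≡0 {L} ≤-refl)))) ⟩
        fromℕ (suc L) * 0# * F (suc L)                  ≈⟨ trans (*-congʳ (zeroʳ _)) (zeroˡ _) ⟩
        0#                                              ∎

    S₂-recurrence : ∀ m → fromℕ (S₂ (suc L) (suc m)) * F (suc m) ≈ g (suc m) ⊕ a m
    S₂-recurrence m = trans (*-congʳ (fromℕ-+ (suc m ℕ.* S₂ L (suc m)) (S₂ L m))) (distribʳ _ _ _)

  sumTo-pow≈sumTo-falling : ∀ n (a : ℕ → Carrier) x →
    sumTo n (λ L → a L * x ^' L) ≈
    sumTo n (λ m → sumTo (n ∸ m) (λ l → a (l + m) * fromℕ (S₂ (l + m) m)) * falling x m)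
  sumTo-pow≈sumTo-falling n a x = begin
    sumTo n (λ L → a L * x ^' L)
      ≈⟨ sumTo-cong n (λ L _ → *-congˡ (^'≈sumTo-S₂-falling x L)) ⟩
    sumTo n (λ L → a L * sumTo L (λ m → fromℕ (S₂ L m) * falling x m))
      ≈⟨ sumTo-cong n (λ L _ → sumTo-*ˡ L (a L) _) ⟩
    sumTo n (λ L → sumTo L (λ m → a L * (fromℕ (S₂ L m) * falling x m)))
      ≈⟨ sumTo-cong n (λ L _ → sumTo-cong L (λ m → h-diagonal L m)) ⟨
    sumTo n (λ L → sumTo L (λ m → h m (L ∸ m)))
      ≈⟨ sumTo-triangle n h ⟨
    sumTo n (λ m → sumTo (n ∸ m) (h m))
      ≈⟨ sumTo-cong n (λ m _ → sumTo-*ʳ (n ∸ m) (falling x m) _) ⟨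
    sumTo n (λ m → sumTo (n ∸ m) (λ l → a (l + m) * fromℕ (S₂ (l + m) m)) * falling x m) ∎
    where
    h : ℕ → ℕ → Carrier
    h m l = a (l + m) * fromℕ (S₂ (l + m) m) * falling x m

    h-diagonal : ∀ L m → m ≤ L → h m (L ∸ m) ≈ a L * (fromℕ (S₂ L m) * falling x m)
    h-diagonal L m m≤L rewrite m∸n+n≡m m≤L = *-assoc _ _ _

  module _ (inv : ℕ → Carrier) where
    open WithInverses inv

    mulS-expS-0# : ∀ F n → mulS F (expS 0#) n ≈ F n
    mulS-expS-0# F zero    = trans (*-congˡ (*-identityʳ 1#)) (*-identityʳ _)
    mulS-expS-0# F (suc n) = begin
      sumTo n (λ i → F i * expS 0# (suc n ∸ i)) ⊕ F (suc n) * expS 0# (n ∸ n)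
        ≈⟨ +-cong (sumTo-zero n F*e₀≈0) (*-congˡ (reflexive (≡.cong (expS 0#) (n∸n≡0 n)))) ⟩
      0# ⊕ F (suc n) * (1# * 1#)   ≈⟨ +-identityˡ _ ⟩
      F (suc n) * (1# * 1#)        ≈⟨ trans (*-congˡ (*-identityʳ 1#)) (*-identityʳ _) ⟩
      F (suc n)                    ∎
      where
      F*e₀≈0 : ∀ i → i ≤ n → F i * expS 0# (suc n ∸ i) ≈ 0#
      F*e₀≈0 i i≤n = begin
        F i * expS 0# (suc n ∸ i)                         ≈⟨ *-congˡ (reflexive (≡.cong (expS 0#) (+-∸-assoc 1 i≤n))) ⟩
        F i * ((0# * 0# ^' (n ∸ i)) * invFact (suc (n ∸ i))) ≈⟨ *-congˡ (trans (*-congʳ (zeroˡ _)) (zeroˡ _)) ⟩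
        F i * 0#                                           ≈⟨ zeroʳ _ ⟩
        0#                                                 ∎

    module _ (inv-correct : ∀ n → fromℕ (suc n) * inv n ≈ 1#) where

      fromℕ[n!]*invFact≈1 : ∀ n → fromℕ (n !) * invFact n ≈ 1#
      fromℕ[n!]*invFact≈1 zero    = trans (*-identityʳ _) (+-identityʳ _)
      fromℕ[n!]*invFact≈1 (suc n) = begin
        fromℕ (suc n ℕ.* n !) * (invFact n * inv n)
          ≈⟨ *-congʳ (fromℕ-* (suc n) (n !)) ⟩
        fromℕ (suc n) * fromℕ (n !) * (invFact n * inv n)
          ≈⟨ solve 4 (λ a b c d → (a ⊗ b) ⊗ (c ⊗ d) ⊜ (b ⊗ c) ⊗ (a ⊗ d)) refl _ _ _ _ ⟩
        fromℕ (n !) * invFact n * (fromℕ (suc n) * inv n)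
          ≈⟨ *-cong (fromℕ[n!]*invFact≈1 n) (inv-correct n) ⟩
        1# * 1#                                           ≈⟨ *-identityʳ _ ⟩
        1#                                                ∎

      n!*mulS-expS : ∀ F n x → fromℕ (n !) * mulS F (expS x) n ≈
        sumTo n (λ L → fromℕ (n C L) * (fromℕ ((n ∸ L) !) * F (n ∸ L)) * x ^' L)
      n!*mulS-expS F n x = begin
        fromℕ (n !) * sumTo n (λ i → F i * expS x (n ∸ i))
          ≈⟨ sumTo-*ˡ n _ _ ⟩
        sumTo n (λ i → fromℕ (n !) * (F i * expS x (n ∸ i)))
          ≈⟨ sumTo-reverse n _ ⟩
        sumTo n (λ L → fromℕ (n !) * (F (n ∸ L) * expS x (n ∸ (n ∸ L))))
          ≈⟨ sumTo-cong n term ⟩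
        sumTo n (λ L → fromℕ (n C L) * (fromℕ ((n ∸ L) !) * F (n ∸ L)) * x ^' L) ∎
        where
        term : ∀ L → L ≤ n → fromℕ (n !) * (F (n ∸ L) * expS x (n ∸ (n ∸ L))) ≈
                             fromℕ (n C L) * (fromℕ ((n ∸ L) !) * F (n ∸ L)) * x ^' L
        term L L≤n = begin
          fromℕ (n !) * (F (n ∸ L) * expS x (n ∸ (n ∸ L)))
            ≈⟨ reflexive (≡.cong₂ (λ a j → fromℕ a * (F (n ∸ L) * expS x j))
                                   (n!≡nCk*[k!*[n∸k]!] L≤n) (m∸[m∸n]≡n L≤n)) ⟩
          fromℕ ((n C L) ℕ.* (L ! ℕ.* (n ∸ L) !)) * (F (n ∸ L) * (x ^' L * invFact L))
            ≈⟨ *-congʳ (trans (fromℕ-* (n C L) _) (*-congˡ (fromℕ-* (L !) _))) ⟩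
          fromℕ (n C L) * (fromℕ (L !) * fromℕ ((n ∸ L) !)) * (F (n ∸ L) * (x ^' L * invFact L))
            ≈⟨ solve 6 (λ c l t f y i → (c ⊗ (l ⊗ t)) ⊗ (f ⊗ (y ⊗ i)) ⊜ ((c ⊗ (t ⊗ f)) ⊗ y) ⊗ (l ⊗ i))
                       refl _ _ _ _ _ _ ⟩
          fromℕ (n C L) * (fromℕ ((n ∸ L) !) * F (n ∸ L)) * x ^' L * (fromℕ (L !) * invFact L)
            ≈⟨ trans (*-congˡ (fromℕ[n!]*invFact≈1 L)) (*-identityʳ _) ⟩
          fromℕ (n C L) * (fromℕ ((n ∸ L) !) * F (n ∸ L)) * x ^' L ∎

      T-appell : ∀ λ' μ r k n x →
        T λ' μ r k n x ≈ sumTo n (λ L → fromℕ (n C L) * T λ' μ r k (n ∸ L) 0# * x ^' L)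
      T-appell λ' μ r k n x = trans (n!*mulS-expS F n x)
        (sumTo-cong n (λ L _ → *-congʳ (*-congˡ (*-congˡ (sym (mulS-expS-0# F (n ∸ L)))))))
        where F = mulS (factorR λ' μ r) (liS k)

theorem9 : ∀ {c ℓ} (R : CommutativeRing c ℓ) →
    let open CommutativeRing R hiding (_+_) in let open Series R in
    (inv : ℕ → Carrier) → (∀ n → fromℕ (suc n) * inv n ≈ 1#) →
    let open WithInverses inv in
    (λ' μ : Carrier) → (1# - λ') * μ ≈ 1# →
    (r k : ℤ) (n : ℕ) (x : Carrier) →
    T λ' μ r k n x ≈
      sumTo n (λ m →
        sumTo (n ∸ m) (λ l →
          fromℕ (n C (l + m)) * fromℕ (S₂ (l + m) m) * T λ' μ r k (n ∸ m ∸ l) 0#)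
        * falling x m)
theorem9 R inv inv-correct λ' μ _ r k n x = begin
  T λ' μ r k n x
    ≈⟨ T-appell inv inv-correct λ' μ r k n x ⟩
  sumTo n (λ L → a L * x ^' L)
    ≈⟨ sumTo-pow≈sumTo-falling n a x ⟩
  sumTo n (λ m → sumTo (n ∸ m) (λ l → a (l + m) * fromℕ (S₂ (l + m) m)) * falling x m)
    ≈⟨ sumTo-cong n (λ m _ → *-congʳ (sumTo-cong (n ∸ m) (λ l _ → reorder m l))) ⟩
  sumTo n (λ m →
    sumTo (n ∸ m) (λ l → fromℕ (n C (l + m)) * fromℕ (S₂ (l + m) m) * T λ' μ r k (n ∸ m ∸ l) 0#)
    * falling x m) ∎
  where
  open CommutativeRing R hiding (_+_)
  open Series R
  open WithInverses inv
  open Properties R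
  open SetoidReasoning setoid
  open CommutativeMonoidSolver *-commutativeMonoid using (solve; _⊜_) renaming (_⊕_ to _⊗_)

  a : ℕ → Carrier
  a L = fromℕ (n C L) * T λ' μ r k (n ∸ L) 0#

  reorder : ∀ m l → a (l + m) * fromℕ (S₂ (l + m) m) ≈
                    fromℕ (n C (l + m)) * fromℕ (S₂ (l + m) m) * T λ' μ r k (n ∸ m ∸ l) 0#
  reorder m l rewrite ∸-+-assoc n m l | ℕₚ.+-comm l m =
    solve 3 (λ c t s → (c ⊗ t) ⊗ s ⊜ (c ⊗ s) ⊗ t) refl _ _ _
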